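{- Let $b_n=\#\Pi_n(123,\,12|3)$ and $g(x)=\sum_{n\ge0}b_n\frac{x^n}{n!}$. Then $b_0=1$, $b_1=1$, $b_2=2$, and for $n\geq3$, $$b_n=b_{n-1}+(n-2)b_{n-3};$$ moreover $y=g(x)$ satisfies $y'''=y''+xy'+y$.
   Context: $\Pi_n$ is the set of set partitions of $[n]=\{1,\dots,n\}$ ($\Pi_0$ consists of the empty partition), written $B_1/B_2/\cdots/B_k$ with blocks in canonical order $\min B_1<\cdots<\min B_k$; blocks $B_i$ and $B_{i+1}$ are called adjacent. $\sigma$ avoids the pattern $123$ if every block of $\sigma$ has at most $2$ elements (i.e. no three elements lie in a common block). The generalized pattern $12|3$: $\sigma$ contains $12|3$ if there are $a<b<c$ in $[n]$ with $a,b$ in one block $B$ of $\sigma$ and $c$ in a different block $B'$ such that $B$ and $B'$ are adjacent (in either order); otherwise $\sigma$ avoids it. $\Pi_n(123,12|3)$ is the set of $\sigma\in\Pi_n$ avoiding both $123$ and $12|3$. -}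

module Defs where

open import Data.Nat using (ℕ; zero; suc; _+_; _*_; _<_; _!)
open import Data.Nat.Properties using (_≟_; _<?_; _!≢0)
open import Data.Fin using (Fin; toℕ)
open import Data.Fin.Properties using (any?; all?)
open import Data.Vec using (Vec; []; _∷_; lookup)
open import Data.List using (List; [_]; concatMap; map; upTo; filter; length)
open import Data.Product using (_×_; ∃; ∃-syntax; _,_)
open import Data.Sum using (_⊎_)
open import Data.Unit using (⊤)
open import Data.Integer using (+_)
open import Data.Rational using (ℚ; _/_)
open import Relation.Nullary using (Dec; yes; ¬_)
open import Relation.Nullary.Decidable using (_×-dec_; _⊎-dec_; ¬?)
open import Relation.Binary.PropositionalEquality using (_≡_)

-- Set partitions of [n] encoded as restricted growth strings.
-- A word v = v₀ … v_{n-1} encodes the partition whose blocks are the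
-- level sets {i | v i = k}; element i+1 of [n] is position i.
-- The canonical-order convention (blocks listed by increasing minima,
-- block B_{k+1} labelled k) is exactly the restricted-growth condition:
-- if position i carries label k+1 then label k occurs at an earlier
-- position. This is a bijection between Π_n and such words.

RGSAt : ∀ {n} → Vec ℕ n → Fin n → Set
RGSAt v i with lookup v i
... | zero  = ⊤
... | suc k = ∃[ j ] (toℕ j < toℕ i × lookup v j ≡ k)

IsSetPartition : ∀ {n} → Vec ℕ n → Set
IsSetPartition v = ∀ i → RGSAt v i

Contains123 : ∀ {n} → Vec ℕ n → Set
Contains123 {n} v =
  ∃[ a ] ∃[ b ] ∃[ c ] (toℕ a < toℕ b × toℕ b < toℕ c ×
    lookup v a ≡ lookup v b × lookup v b ≡ lookup v c)

-- σ contains 12|3: a<b<c with a,b in a block B and c in a block B'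
-- adjacent to B (canonical indices differ by one, in either order).
Contains12∣3 : ∀ {n} → Vec ℕ n → Set
Contains12∣3 {n} v =
  ∃[ a ] ∃[ b ] ∃[ c ] (toℕ a < toℕ b × toℕ b < toℕ c ×
    lookup v a ≡ lookup v b ×
    (lookup v c ≡ suc (lookup v a) ⊎ lookup v a ≡ suc (lookup v c)))

InΠ-123-12∣3 : ∀ {n} → Vec ℕ n → Set
InΠ-123-12∣3 v = IsSetPartition v × ¬ Contains123 v × ¬ Contains12∣3 v

rgsAt? : ∀ {n} (v : Vec ℕ n) i → Dec (RGSAt v i)
rgsAt? v i with lookup v i
... | zero  = yes _
... | suc k = any? (λ j → (toℕ j <? toℕ i) ×-dec (lookup v j ≟ k))

contains123? : ∀ {n} (v : Vec ℕ n) → Dec (Contains123 v)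
contains123? v = any? λ a → any? λ b → any? λ c →
  (toℕ a <? toℕ b) ×-dec (toℕ b <? toℕ c) ×-dec
  (lookup v a ≟ lookup v b) ×-dec (lookup v b ≟ lookup v c)

contains12∣3? : ∀ {n} (v : Vec ℕ n) → Dec (Contains12∣3 v)
contains12∣3? v = any? λ a → any? λ b → any? λ c →
  (toℕ a <? toℕ b) ×-dec (toℕ b <? toℕ c) ×-dec
  (lookup v a ≟ lookup v b) ×-dec
  ((lookup v c ≟ suc (lookup v a)) ⊎-dec (lookup v a ≟ suc (lookup v c)))

inΠ? : ∀ {n} (v : Vec ℕ n) → Dec (InΠ-123-12∣3 v)
inΠ? v = all? (rgsAt? v) ×-dec ¬? (contains123? v) ×-dec ¬? (contains12∣3? v)

words : (n m : ℕ) → List (Vec ℕ n)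
words zero    m = [ [] ]
words (suc n) m = concatMap (λ x → map (x ∷_) (words n m)) (upTo m)

-- b n = #Π_n(123, 12|3).  Every restricted growth word of length n has
-- all letters < n, so words n n contains every partition exactly once.
b : ℕ → ℕ
b n = length (filter inΠ? (words n n))

Series : Set
Series = ℕ → ℚ

-- f' : coefficient of x^n in f' is (n+1) · [x^{n+1}] f
D : Series → Series
D f n = (+ suc n / 1) Data.Rational.* f (suc n)

X : Series → Series
X f zero    = Data.Rational.0ℚ
X f (suc n) = f n

_⊕_ : Series → Series → Series
(f ⊕ g) n = f n Data.Rational.+ g n
infixl 6 _⊕_

egf : (ℕ → ℕ) → Series
egf a n = (+ a n / n !) {{n !≢0}}

-- For n ≥ 3 the elements 1 and 2 of an avoider lie in different blocks, since 3 would either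
-- join their block or open the adjacent one.  Either {1} is a block, and deleting it leaves an
-- arbitrary avoider of [n-1]; or 1 has a partner j ∈ {3, …, n}, and then {2} is a block and every
-- other element lies in a block to the right of both, so deleting 1, 2, j leaves an arbitrary
-- avoider of [n-3].  Hence b_n = b_{n-1} + (n-2) b_{n-3}.  On exponential generating functions,
-- differentiation shifts the coefficient sequence and x·d/dx multiplies b_n by n, so the
-- differential equation is the recurrence read coefficientwise.
module Submission where

open import Defs

open import Data.Nat
  using (ℕ; zero; suc; _+_; _*_; _∸_; _≤_; _<_; z≤n; s≤s; z<s; s<s; _≤?_; _≟_; NonZero; _!)
open import Data.Nat.Properties
  using (+-suc; +-cancelˡ-≡; +-assoc; +-comm; *-assoc; *-identityˡ; *-distribʳ-+; _!≢0;
         m≤m+n; m+[n∸m]≡n; ≤-trans; ≤-<-trans; <-irrefl; <-asym; ≰⇒>; <⇒≤;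
         n≤0⇒n≡0; n<1⇒n≡0; n≮0; 1+n≢0; n≢0⇒n>0; m<n⇒0<n; suc-injective)
open import Data.Nat.Tactic.RingSolver using (solve-∀)
open import Data.Fin as Fin using (Fin; zero; suc; toℕ; punchIn; punchOut)
import Data.Fin.Properties as Fin
open import Data.Vec using (Vec; []; _∷_; lookup; map; insertAt; removeAt)
open import Data.Vec.Properties
  using (lookup-map; insertAt-lookup; insertAt-punchIn; removeAt-punchOut; insertAt-removeAt;
         ∷-injective; ∷-injectiveˡ; ∷-injectiveʳ)
open import Data.Vec.Membership.Propositional using (_∉_)
open import Data.Vec.Relation.Unary.Any using (here; there)
import Data.List as List
open List using (List; _++_; length; filter; upTo; allFin; concatMap; cartesianProductWith)
open import Data.List.Properties using (length-++; length-map; length-tabulate)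
open import Data.List.Relation.Unary.Any using (here; there)
open import Data.List.Relation.Unary.All using (All; []; _∷_)
import Data.List.Relation.Unary.All as All
import Data.List.Relation.Unary.All.Properties as All
open import Data.List.Relation.Unary.AllPairs using ([]; _∷_)
open import Data.List.Relation.Unary.Unique.Propositional using (Unique)
open import Data.List.Relation.Unary.Unique.Propositional.Properties
  using (map⁺; ++⁺; cartesianProductWith⁺; upTo⁺; allFin⁺; filter⁺)
open import Data.List.Membership.Propositional using (_∈_)
open import Data.List.Membership.Propositional.Properties
  using (∈-map⁺; ∈-map⁻; ∈-++⁺ˡ; ∈-++⁺ʳ; ∈-cartesianProductWith⁺; ∈-cartesianProductWith⁻;
         ∈-allFin; ∈-upTo⁺; ∈-filter⁺; ∈-filter⁻)
open import Data.List.Membership.Propositional.Properties.WithK using (unique∧set⇒bag)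
open import Data.List.Relation.Binary.BagAndSetEquality using (∼bag⇒↭)
open import Data.List.Relation.Binary.Permutation.Propositional.Properties using (↭-length)
open import Data.List.Relation.Binary.Disjoint.Propositional using (Disjoint)
import Data.Integer as ℤ
open import Data.Integer.Properties using (pos-+; pos-*)
import Data.Rational as ℚ
open ℚ using (fromℚᵘ)
open import Data.Rational.Properties
  using (toℚᵘ-injective; toℚᵘ-fromℚᵘ; toℚᵘ-homo-+; toℚᵘ-homo-*; fromℚᵘ-cong; /-cong)
import Data.Rational.Unnormalised as ℚᵘ
open ℚᵘ using (mkℚᵘ; *≡*)
import Data.Rational.Unnormalised.Properties as ℚᵘ
open import Data.Product using (_×_; _,_; proj₁; proj₂; ∃-syntax)
import Data.Sum as Sum
open Sum using (_⊎_; inj₁; inj₂)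
open import Data.Unit using (tt)
open import Data.Empty using (⊥-elim)
open import Function using (_∘_)
open import Function.Bundles using (_⇔_; mk⇔)
open import Relation.Nullary using (¬_; yes; no; contradiction)
open import Relation.Nullary.Decidable using (from-yes)
open import Relation.Binary.Definitions using (tri<; tri≈; tri>)
open import Relation.Binary.PropositionalEquality
  using (_≡_; _≢_; setoid; refl; sym; trans; cong; cong₂; subst; subst₂; module ≡-Reasoning)

map-+-∸ : ∀ {n} c (xs : Vec ℕ n) → (∀ i → c ≤ lookup xs i) → map (c +_) (map (_∸ c) xs) ≡ xs
map-+-∸ c []       _     = refl
map-+-∸ c (x ∷ xs) c≤xs = cong₂ _∷_ (m+[n∸m]≡n (c≤xs zero)) (map-+-∸ c xs (λ i → c≤xs (suc i)))

lookup-removeAt : ∀ {A : Set} {n} (xs : Vec A (suc n)) p j →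
                  lookup (removeAt xs p) j ≡ lookup xs (punchIn p j)
lookup-removeAt xs p j =
  trans (cong (lookup (removeAt xs p)) (sym (Fin.punchOut-punchIn p)))
        (removeAt-punchOut xs (Fin.punchInᵢ≢i p j ∘ sym))

map-injective : ∀ {A B : Set} {f : A → B} {n} → (∀ {x y} → f x ≡ f y → x ≡ y) →
                ∀ {xs ys : Vec A n} → map f xs ≡ map f ys → xs ≡ ys
map-injective f-inj {[]}     {[]}     _  = refl
map-injective f-inj {x ∷ xs} {y ∷ ys} eq =
  cong₂ _∷_ (f-inj (∷-injectiveˡ eq)) (map-injective f-inj (∷-injectiveʳ eq))

insertAt-injective : ∀ {A : Set} {n} {xs ys : Vec A n} {p q x} → x ∉ xs → x ∉ ys →
                     insertAt xs p x ≡ insertAt ys q x → p ≡ q × xs ≡ ys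
insertAt-injective {p = zero} {zero} _ _ eq = refl , ∷-injectiveʳ eq
insertAt-injective {ys = _ ∷ _} {zero} {suc _} _ x∉ys eq =
  contradiction (here (∷-injectiveˡ eq)) x∉ys
insertAt-injective {xs = _ ∷ _} {p = suc _} {zero} x∉xs _ eq =
  contradiction (here (sym (∷-injectiveˡ eq))) x∉xs
insertAt-injective {xs = _ ∷ _} {_ ∷ _} {suc _} {suc _} x∉xs x∉ys eq with ∷-injective eq
... | refl , eq′ with insertAt-injective (x∉xs ∘ there) (x∉ys ∘ there) eq′
...   | refl , refl = refl , refl

punchIn-mono-< : ∀ {n} (p : Fin (suc n)) {i j} →
                 toℕ i < toℕ j → toℕ (punchIn p i) < toℕ (punchIn p j)
punchIn-mono-< p {i} {j} i<j =
  Fin.≤∧≢⇒< (Fin.punchIn-mono-≤ p i j (<⇒≤ i<j)) (Fin.<⇒≢ i<j ∘ Fin.punchIn-injective p i j)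

length-cartesianProductWith : ∀ {A B C : Set} (f : A → B → C) xs ys →
                              length (cartesianProductWith f xs ys) ≡ length xs * length ys
length-cartesianProductWith f List.[]         ys = refl
length-cartesianProductWith f (x List.∷ xs) ys =
  trans (length-++ (List.map (f x) ys))
        (cong₂ _+_ (length-map (f x) ys) (length-cartesianProductWith f xs ys))

concatMap-map≡cartesianProductWith : ∀ {A B C : Set} (f : A → B → C) xs ys →
  concatMap (λ x → List.map (f x) ys) xs ≡ cartesianProductWith f xs ys
concatMap-map≡cartesianProductWith f List.[]       ys = refl
concatMap-map≡cartesianProductWith f (x List.∷ xs) ys =
  cong (List.map (f x) ys ++_) (concatMap-map≡cartesianProductWith f xs ys)

unique∧set⇒length≡ : ∀ {A : Set} {xs ys : List A} → Unique xs → Unique ys →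
                     (∀ {x} → x ∈ xs ⇔ x ∈ ys) → length xs ≡ length ys
unique∧set⇒length≡ xs! ys! xs⇔ys = ↭-length (∼bag⇒↭ (unique∧set⇒bag xs! ys! xs⇔ys))

RestrictedGrowth : ∀ {n} → Vec ℕ n → Set
RestrictedGrowth v = ∀ i {k} → lookup v i ≡ suc k → ∃[ j ] (toℕ j < toℕ i × lookup v j ≡ k)

module _ {n} {v : Vec ℕ n} where

  partition⇒growth : IsSetPartition v → RestrictedGrowth v
  partition⇒growth P i eq with lookup v i | P i | eq
  ... | suc _ | earlier | refl = earlier

  growth⇒partition : RestrictedGrowth v → IsSetPartition v
  growth⇒partition G i with lookup v i | G i
  ... | zero  | _       = tt
  ... | suc _ | earlier = earlier refl

  label≤index : IsSetPartition v → ∀ i → lookup v i ≤ toℕ i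
  label≤index P i = go i refl
    where
    go : ∀ {k} i → lookup v i ≡ k → k ≤ toℕ i
    go {zero}  i _  = z≤n
    go {suc k} i eq with partition⇒growth P i eq
    ... | j , j<i , eqj = ≤-<-trans (go j eqj) j<i

  label<length : IsSetPartition v → ∀ i → lookup v i < n
  label<length P i = ≤-<-trans (label≤index P i) (Fin.toℕ<n i)

head-zero : ∀ {n} {v : Vec ℕ (suc n)} → IsSetPartition v → lookup v zero ≡ 0
head-zero P = n≤0⇒n≡0 (label≤index P zero)

Adjacent : ℕ → ℕ → Set
Adjacent x y = y ≡ suc x ⊎ x ≡ suc y

adjacent-+ˡ : ∀ c {x y} → Adjacent x y → Adjacent (c + x) (c + y)
adjacent-+ˡ c = Sum.map shift shift
  where
  shift : ∀ {x y} → y ≡ suc x → c + y ≡ suc (c + x)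
  shift eq = trans (cong (c +_) eq) (+-suc c _)

adjacent-cancel-+ˡ : ∀ c {x y} → Adjacent (c + x) (c + y) → Adjacent x y
adjacent-cancel-+ˡ c = Sum.map unshift unshift
  where
  unshift : ∀ {x y} → c + y ≡ suc (c + x) → y ≡ suc x
  unshift eq = +-cancelˡ-≡ c _ _ (trans eq (sym (+-suc c _)))

adjacent-below2 : ∀ {x y} → Adjacent x y → x < 2 ⊎ y < 2 → x ≡ 1 ⊎ y ≡ 1
adjacent-below2 {0} (inj₁ refl) _ = inj₂ refl
adjacent-below2 {1} _ _ = inj₁ refl
adjacent-below2 {suc (suc x)} {0} (inj₁ ()) _
adjacent-below2 {suc (suc x)} {0} (inj₂ ()) _
adjacent-below2 {suc (suc x)} {1} _ _ = inj₂ refl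
adjacent-below2 {suc (suc x)} {suc (suc y)} _ (inj₁ (s≤s (s≤s ())))
adjacent-below2 {suc (suc x)} {suc (suc y)} _ (inj₂ (s≤s (s≤s ())))

Occurrence123 : ∀ {n} → Vec ℕ n → (a b d : Fin n) → Set
Occurrence123 v a b d =
  toℕ a < toℕ b × toℕ b < toℕ d × lookup v a ≡ lookup v b × lookup v b ≡ lookup v d

Occurrence12∣3 : ∀ {n} → Vec ℕ n → (a b d : Fin n) → Set
Occurrence12∣3 v a b d =
  toℕ a < toℕ b × toℕ b < toℕ d × lookup v a ≡ lookup v b × Adjacent (lookup v a) (lookup v d)

third≥2 : ∀ {n} {a b d : Fin n} → toℕ a < toℕ b → toℕ b < toℕ d → 2 ≤ toℕ d
third≥2 a<b b<d = ≤-trans (s≤s (m<n⇒0<n a<b)) b<d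

-- w is the word read off the blocks of v with labels ≥ c, relabelled by subtracting c.
record Restriction {m n} (v : Vec ℕ n) (c : ℕ) (w : Vec ℕ m) : Set where
  field
    pos        : Fin m → Fin n
    pos-mono   : ∀ {i j} → toℕ i < toℕ j → toℕ (pos i) < toℕ (pos j)
    lookup-pos : ∀ i → lookup v (pos i) ≡ c + lookup w i
    pos-onto   : ∀ q → c ≤ lookup v q → ∃[ i ] pos i ≡ q

module RestrictionProperties {m n} {v : Vec ℕ n} {c} {w : Vec ℕ m} (R : Restriction v c w) where
  open Restriction R

  pos-cancel-< : ∀ {i j} → toℕ (pos i) < toℕ (pos j) → toℕ i < toℕ j
  pos-cancel-< {i} {j} p<p with Fin.<-cmp i j
  ... | tri< i<j _ _ = i<j
  ... | tri≈ _ refl _ = contradiction p<p (<-irrefl refl)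
  ... | tri> _ _ j<i = contradiction (pos-mono j<i) (<-asym p<p)

  c≤lookup-pos : ∀ i → c ≤ lookup v (pos i)
  c≤lookup-pos i = subst (c ≤_) (sym (lookup-pos i)) (m≤m+n c _)

  head-or-pos : ∀ q → lookup v q < c ⊎ ∃[ i ] pos i ≡ q
  head-or-pos q with c ≤? lookup v q
  ... | yes c≤ = inj₂ (pos-onto q c≤)
  ... | no c≰  = inj₁ (≰⇒> c≰)

  ≡-pos⁺ : ∀ {i j} → lookup w i ≡ lookup w j → lookup v (pos i) ≡ lookup v (pos j)
  ≡-pos⁺ {i} {j} eq = subst₂ _≡_ (sym (lookup-pos i)) (sym (lookup-pos j)) (cong (c +_) eq)

  ≡-pos⁻ : ∀ {i j} → lookup v (pos i) ≡ lookup v (pos j) → lookup w i ≡ lookup w j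
  ≡-pos⁻ {i} {j} eq = +-cancelˡ-≡ c _ _ (subst₂ _≡_ (lookup-pos i) (lookup-pos j) eq)

  adjacent-pos⁺ : ∀ {i j} → Adjacent (lookup w i) (lookup w j) →
                  Adjacent (lookup v (pos i)) (lookup v (pos j))
  adjacent-pos⁺ {i} {j} adj =
    subst₂ Adjacent (sym (lookup-pos i)) (sym (lookup-pos j)) (adjacent-+ˡ c adj)

  adjacent-pos⁻ : ∀ {i j} → Adjacent (lookup v (pos i)) (lookup v (pos j)) →
                  Adjacent (lookup w i) (lookup w j)
  adjacent-pos⁻ {i} {j} adj = adjacent-cancel-+ˡ c (subst₂ Adjacent (lookup-pos i) (lookup-pos j) adj)

  pos-123⁺ : ∀ {i j k} → Occurrence123 w i j k → Occurrence123 v (pos i) (pos j) (pos k)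
  pos-123⁺ (i<j , j<k , ij , jk) = pos-mono i<j , pos-mono j<k , ≡-pos⁺ ij , ≡-pos⁺ jk

  pos-123⁻ : ∀ {i j k} → Occurrence123 v (pos i) (pos j) (pos k) → Occurrence123 w i j k
  pos-123⁻ (i<j , j<k , ij , jk) = pos-cancel-< i<j , pos-cancel-< j<k , ≡-pos⁻ ij , ≡-pos⁻ jk

  pos-12∣3⁺ : ∀ {i j k} → Occurrence12∣3 w i j k → Occurrence12∣3 v (pos i) (pos j) (pos k)
  pos-12∣3⁺ (i<j , j<k , ij , adj) = pos-mono i<j , pos-mono j<k , ≡-pos⁺ ij , adjacent-pos⁺ adj

  pos-12∣3⁻ : ∀ {i j k} → Occurrence12∣3 v (pos i) (pos j) (pos k) → Occurrence12∣3 w i j k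
  pos-12∣3⁻ (i<j , j<k , ij , adj) = pos-cancel-< i<j , pos-cancel-< j<k , ≡-pos⁻ ij , adjacent-pos⁻ adj

  restrict-growth : RestrictedGrowth v → RestrictedGrowth w
  restrict-growth G i {k} eq
    with G (pos i) (trans (lookup-pos i) (trans (cong (c +_) eq) (+-suc c k)))
  ... | q , q<i , eqq with pos-onto q (subst (c ≤_) (sym eqq) (m≤m+n c k))
  ... | j , refl = j , pos-cancel-< q<i , +-cancelˡ-≡ c _ _ (trans (sym (lookup-pos j)) eqq)

  extend-growth : RestrictedGrowth w → ∀ i {k} → lookup w i ≡ suc k →
                  ∃[ j ] (toℕ j < toℕ (pos i) × lookup v j ≡ c + k)
  extend-growth G i eq with G i eq
  ... | j , j<i , eqj = pos j , pos-mono j<i , trans (lookup-pos j) (cong (c +_) eqj)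

  restrict-InΠ : InΠ-123-12∣3 v → InΠ-123-12∣3 w
  restrict-InΠ (P , no123 , no12∣3) =
    growth⇒partition (restrict-growth (partition⇒growth P)) ,
    (λ (i , j , k , occ) → no123 (pos i , pos j , pos k , pos-123⁺ occ)) ,
    (λ (i , j , k , occ) → no12∣3 (pos i , pos j , pos k , pos-12∣3⁺ occ))

  occurrence123-below : ¬ Contains123 w → ∀ {a b d} → Occurrence123 v a b d → lookup v a < c
  occurrence123-below no123 {a} {b} {d} occ@(_ , _ , ab , bd) with head-or-pos a
  ... | inj₁ a<c = a<c
  ... | inj₂ (i , refl)
    with pos-onto b (subst (c ≤_) ab (c≤lookup-pos i))
       | pos-onto d (subst (c ≤_) (trans ab bd) (c≤lookup-pos i))
  ... | j , refl | k , refl = ⊥-elim (no123 (i , j , k , pos-123⁻ occ))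

  occurrence12∣3-below : ¬ Contains12∣3 w → ∀ {a b d} → Occurrence12∣3 v a b d →
                         lookup v a < c ⊎ lookup v d < c
  occurrence12∣3-below no12∣3 {a} {b} {d} occ@(_ , _ , ab , _) with head-or-pos a | head-or-pos d
  ... | inj₁ a<c | _        = inj₁ a<c
  ... | inj₂ _   | inj₁ d<c = inj₂ d<c
  ... | inj₂ (i , refl) | inj₂ (k , refl) with pos-onto b (subst (c ≤_) ab (c≤lookup-pos i))
  ... | j , refl = ⊥-elim (no12∣3 (i , j , k , pos-12∣3⁻ occ))

singletonFront : ∀ {n} → Vec ℕ n → Vec ℕ (suc n)
singletonFront w = 0 ∷ map suc w

module _ {n} {w : Vec ℕ n} where

  singletonFront-restriction : Restriction (singletonFront w) 1 w
  singletonFront-restriction = record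
    { pos = suc ; pos-mono = s<s ; lookup-pos = λ i → lookup-map i suc w ; pos-onto = onto }
    where
    onto : ∀ q → 1 ≤ lookup (singletonFront w) q → ∃[ i ] suc i ≡ q
    onto (suc i) _ = i , refl

  singletonFront-label0 : ∀ {q} → lookup (singletonFront w) q ≡ 0 → toℕ q ≡ 0
  singletonFront-label0 {zero}  _  = refl
  singletonFront-label0 {suc i} eq = contradiction (trans (sym (lookup-map i suc w)) eq) 1+n≢0

  open RestrictionProperties singletonFront-restriction

  singletonFront-InΠ⁺ : InΠ-123-12∣3 w → InΠ-123-12∣3 (singletonFront w)
  singletonFront-InΠ⁺ (P , no123 , no12∣3) = growth⇒partition growth , no123′ , no12∣3′
    where
    growth : RestrictedGrowth (singletonFront w)
    growth (suc i) {zero}  _  = zero , z<s , refl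
    growth (suc i) {suc k} eq =
      extend-growth (partition⇒growth P) i (suc-injective (trans (sym (lookup-map i suc w)) eq))

    no123′ : ¬ Contains123 (singletonFront w)
    no123′ (a , b , d , occ@(a<b , _ , ab , _)) = n≮0 (subst (toℕ a <_) b≡0 a<b)
      where
      b≡0 : toℕ b ≡ 0
      b≡0 = singletonFront-label0 (trans (sym ab) (n<1⇒n≡0 (occurrence123-below no123 occ)))

    no12∣3′ : ¬ Contains12∣3 (singletonFront w)
    no12∣3′ (a , b , d , occ@(a<b , b<d , ab , _)) with occurrence12∣3-below no12∣3 occ
    ... | inj₁ a<1 = n≮0 (subst (toℕ a <_) (singletonFront-label0 (trans (sym ab) (n<1⇒n≡0 a<1))) a<b)
    ... | inj₂ d<1 = n≮0 (subst (toℕ b <_) (singletonFront-label0 (n<1⇒n≡0 d<1)) b<d)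

  singletonFront-InΠ⁻ : InΠ-123-12∣3 (singletonFront w) → InΠ-123-12∣3 w
  singletonFront-InΠ⁻ = restrict-InΠ

-- The partition with blocks {1, p+3} and {2} whose other blocks are those of w,
-- transported to [n+3] ∖ {1, 2, p+3}.
pairFront : ∀ {n} → Fin (suc n) → Vec ℕ n → Vec ℕ (3 + n)
pairFront p w = 0 ∷ 1 ∷ insertAt (map (2 +_) w) p 0

data PairFrontPosition {n} (p : Fin (suc n)) : Fin (3 + n) → Set where
  first   : PairFrontPosition p zero
  second  : PairFrontPosition p (suc zero)
  partner : PairFrontPosition p (suc (suc p))
  shifted : ∀ j → PairFrontPosition p (suc (suc (punchIn p j)))

pairFrontPosition : ∀ {n} (p : Fin (suc n)) q → PairFrontPosition p q
pairFrontPosition p zero          = first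
pairFrontPosition p (suc zero)    = second
pairFrontPosition p (suc (suc q)) with p Fin.≟ q
... | yes refl = partner
... | no p≢q   = subst (λ q → PairFrontPosition p (suc (suc q)))
                       (Fin.punchIn-punchOut p≢q) (shifted (punchOut p≢q))

module _ {n} {p : Fin (suc n)} {w : Vec ℕ n} where

  lookup-partner : lookup (pairFront p w) (suc (suc p)) ≡ 0
  lookup-partner = insertAt-lookup (map (2 +_) w) p 0

  lookup-shifted : ∀ j → lookup (pairFront p w) (suc (suc (punchIn p j))) ≡ 2 + lookup w j
  lookup-shifted j = trans (insertAt-punchIn (map (2 +_) w) p 0 j) (lookup-map j (2 +_) w)

  pairFront-restriction : Restriction (pairFront p w) 2 w
  pairFront-restriction = record
    { pos = λ j → suc (suc (punchIn p j))
    ; pos-mono = s<s ∘ s<s ∘ punchIn-mono-< p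
    ; lookup-pos = lookup-shifted
    ; pos-onto = onto }
    where
    onto : ∀ q → 2 ≤ lookup (pairFront p w) q → ∃[ j ] suc (suc (punchIn p j)) ≡ q
    onto q 2≤ with pairFrontPosition p q
    ... | first     = contradiction 2≤ λ ()
    ... | second    = contradiction 2≤ λ { (s≤s ()) }
    ... | partner   = contradiction (subst (2 ≤_) lookup-partner 2≤) λ ()
    ... | shifted j = j , refl

  pairFront-label0 : ∀ {q} → lookup (pairFront p w) q ≡ 0 → 0 < toℕ q → q ≡ suc (suc p)
  pairFront-label0 {q} eq 0<q with pairFrontPosition p q
  ... | first     = contradiction 0<q λ ()
  ... | second    = contradiction eq 1+n≢0
  ... | partner   = refl
  ... | shifted j = contradiction (trans (sym (lookup-shifted j)) eq) 1+n≢0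

  pairFront-label1 : ∀ {q} → lookup (pairFront p w) q ≡ 1 → toℕ q ≡ 1
  pairFront-label1 {q} eq with pairFrontPosition p q
  ... | first     = contradiction eq λ ()
  ... | second    = refl
  ... | partner   = contradiction (trans (sym lookup-partner) eq) λ ()
  ... | shifted j = contradiction (suc-injective (trans (sym (lookup-shifted j)) eq)) 1+n≢0

  open RestrictionProperties pairFront-restriction

  pairFront-InΠ⁺ : InΠ-123-12∣3 w → InΠ-123-12∣3 (pairFront p w)
  pairFront-InΠ⁺ (P , no123 , no12∣3) = growth⇒partition growth , no123′ , no12∣3′
    where
    growth : RestrictedGrowth (pairFront p w)
    growth q eq with pairFrontPosition p q
    ... | first     = contradiction (sym eq) 1+n≢0
    ... | second    = zero , z<s , suc-injective eq
    ... | partner   = contradiction (trans (sym eq) lookup-partner) 1+n≢0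
    ... | shifted j with lookup w j in wj | suc-injective (trans (sym (lookup-shifted j)) eq)
    ...   | zero  | refl = suc zero , s<s z<s , refl
    ...   | suc _ | refl = extend-growth (partition⇒growth P) j wj

    label1-once : ∀ {a b} → lookup (pairFront p w) a ≡ 1 → lookup (pairFront p w) b ≡ 1 →
                  ¬ toℕ a < toℕ b
    label1-once a≡1 b≡1 = <-irrefl (trans (pairFront-label1 a≡1) (sym (pairFront-label1 b≡1)))

    no123′ : ¬ Contains123 (pairFront p w)
    no123′ (a , b , d , occ@(a<b , b<d , ab , bd))
      with lookup (pairFront p w) a in a≡ | occurrence123-below no123 occ
    ... | 0 | _ = <-irrefl (cong toℕ (trans b≡partner (sym d≡partner))) b<d
      where
      b≡partner : b ≡ suc (suc p)
      b≡partner = pairFront-label0 (trans (sym ab) a≡) (m<n⇒0<n a<b)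
      d≡partner : d ≡ suc (suc p)
      d≡partner = pairFront-label0 (trans (sym bd) (trans (sym ab) a≡)) (m<n⇒0<n b<d)
    ... | 1 | _ = label1-once a≡ (trans (sym ab) a≡) a<b
    ... | suc (suc _) | s≤s (s≤s ())

    no12∣3′ : ¬ Contains12∣3 (pairFront p w)
    no12∣3′ (a , b , d , occ@(a<b , b<d , ab , adj))
      with adjacent-below2 adj (occurrence12∣3-below no12∣3 occ)
    ... | inj₁ a≡1 = label1-once a≡1 (trans (sym ab) a≡1) a<b
    ... | inj₂ d≡1 =
      contradiction (subst (2 ≤_) (pairFront-label1 d≡1) (third≥2 a<b b<d)) λ { (s≤s ()) }

  pairFront-InΠ⁻ : InΠ-123-12∣3 (pairFront p w) → InΠ-123-12∣3 w
  pairFront-InΠ⁻ = restrict-InΠ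

no-leading-pair : ∀ {n} {v : Vec ℕ (3 + n)} → InΠ-123-12∣3 v → lookup v zero ≢ lookup v (suc zero)
no-leading-pair {v = v} (P , no123 , no12∣3) v₀≡v₁ with lookup v (suc (suc zero)) in v₂
... | zero  = no123 (zero , suc zero , suc (suc zero) , z<s , s<s z<s ,
                     v₀≡v₁ , trans (sym v₀≡v₁) (trans (head-zero P) (sym v₂)))
... | suc k with partition⇒growth P (suc (suc zero)) v₂
...   | zero , _ , v₀≡k = no12∣3 (zero , suc zero , suc (suc zero) , z<s , s<s z<s ,
                                   v₀≡v₁ , inj₁ (trans v₂ (cong suc (sym v₀≡k))))
...   | suc zero , _ , v₁≡k = no12∣3 (zero , suc zero , suc (suc zero) , z<s , s<s z<s ,
                                       v₀≡v₁ , inj₁ (trans v₂ (cong suc (trans (sym v₁≡k) (sym v₀≡v₁)))))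
...   | suc (suc _) , s≤s (s≤s ()) , _

second-one : ∀ {n} {v : Vec ℕ (3 + n)} → InΠ-123-12∣3 v → lookup v (suc zero) ≡ 1
second-one {v = v} V@(P , _) with lookup v (suc zero) in v₁ | label≤index P (suc zero)
... | 0 | _ = contradiction (trans (head-zero P) (sym v₁)) (no-leading-pair V)
... | 1 | _ = refl
... | suc (suc _) | s≤s ()

off-partner≥2 : ∀ {n} {u : Vec ℕ (suc n)} {p q} → InΠ-123-12∣3 (0 ∷ 1 ∷ u) →
                lookup u p ≡ 0 → q ≢ p → 2 ≤ lookup u q
off-partner≥2 {u = u} {p} {q} (_ , no123 , no12∣3) up q≢p with lookup u q in uq | Fin.<-cmp q p
... | suc (suc _) | _ = s≤s (s≤s z≤n)
... | _ | tri≈ _ q≡p _ = contradiction q≡p q≢p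
... | 0 | tri< q<p _ _ =
  ⊥-elim (no123 (zero , suc (suc q) , suc (suc p) , z<s , s<s (s<s q<p) , sym uq , trans uq (sym up)))
... | 0 | tri> _ _ p<q =
  ⊥-elim (no123 (zero , suc (suc p) , suc (suc q) , z<s , s<s (s<s p<q) , sym up , trans up (sym uq)))
... | 1 | tri< q<p _ _ =
  ⊥-elim (no12∣3 (suc zero , suc (suc q) , suc (suc p) , s<s z<s , s<s (s<s q<p) ,
                  sym uq , inj₂ (cong suc (sym up))))
... | 1 | tri> _ _ p<q =
  ⊥-elim (no12∣3 (zero , suc (suc p) , suc (suc q) , z<s , s<s (s<s p<q) , sym up , inj₁ uq))

module _ {n} {u : Vec ℕ (suc n)} where

  without-partner : (∀ q → lookup u q ≢ 0) → 1 ∷ u ≡ map suc (map (_∸ 1) (1 ∷ u))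
  without-partner u≢0 = sym (map-+-∸ 1 (1 ∷ u) positive)
    where
    positive : ∀ i → 1 ≤ lookup (1 ∷ u) i
    positive zero    = s≤s z≤n
    positive (suc q) = n≢0⇒n>0 (u≢0 q)

  with-partner : InΠ-123-12∣3 (0 ∷ 1 ∷ u) → ∀ {p} → lookup u p ≡ 0 →
                 u ≡ insertAt (map (2 +_) (map (_∸ 2) (removeAt u p))) p 0
  with-partner V {p} up = begin
    u
      ≡⟨ insertAt-removeAt u p ⟨
    insertAt (removeAt u p) p (lookup u p)
      ≡⟨ cong (insertAt (removeAt u p) p) up ⟩
    insertAt (removeAt u p) p 0
      ≡⟨ cong (λ xs → insertAt xs p 0) (map-+-∸ 2 _ beyond) ⟨
    insertAt (map (2 +_) (map (_∸ 2) (removeAt u p))) p 0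
      ∎
    where
    open ≡-Reasoning
    beyond : ∀ j → 2 ≤ lookup (removeAt u p) j
    beyond j = subst (2 ≤_) (sym (lookup-removeAt u p j)) (off-partner≥2 V up (Fin.punchInᵢ≢i p j))

decompose : ∀ {n} {v : Vec ℕ (3 + n)} → InΠ-123-12∣3 v →
            (∃[ w ] v ≡ singletonFront w) ⊎ (∃[ p ] ∃[ w ] v ≡ pairFront p w)
decompose {v = _ ∷ _ ∷ u} V@(P , _) with head-zero P | second-one V
... | refl | refl with Fin.any? (λ q → lookup u q ≟ 0)
...   | no  no-zero  = inj₁ (_ , cong (0 ∷_) (without-partner (λ q uq → no-zero (q , uq))))
...   | yes (p , up) = inj₂ (p , _ , cong (λ xs → 0 ∷ 1 ∷ xs) (with-partner V up))

0∉map-2+ : ∀ {n} (w : Vec ℕ n) → 0 ∉ map (2 +_) w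
0∉map-2+ (_ ∷ w) (there 0∈) = 0∉map-2+ w 0∈

singletonFront-injective : ∀ {n} {w w′ : Vec ℕ n} → singletonFront w ≡ singletonFront w′ → w ≡ w′
singletonFront-injective = map-injective suc-injective ∘ ∷-injectiveʳ

pairFront-injective : ∀ {n} {p p′ : Fin (suc n)} {w w′ : Vec ℕ n} →
                      pairFront p w ≡ pairFront p′ w′ → p ≡ p′ × w ≡ w′
pairFront-injective {w = w} {w′} eq
  with insertAt-injective (0∉map-2+ w) (0∉map-2+ w′) (∷-injectiveʳ (∷-injectiveʳ eq))
... | refl , eq′ = refl , map-injective (+-cancelˡ-≡ 2 _ _) eq′

singletonFront≢pairFront : ∀ {n} (w : Vec ℕ (2 + n)) p w′ → singletonFront w ≢ pairFront p w′
singletonFront≢pairFront w p w′ eq = 1+n≢0 (begin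
  suc (lookup w (suc p))                 ≡⟨ lookup-map (suc p) suc w ⟨
  lookup (singletonFront w) (suc (suc p)) ≡⟨ cong (λ v → lookup v (suc (suc p))) eq ⟩
  lookup (pairFront p w′) (suc (suc p))   ≡⟨ lookup-partner {p = p} {w = w′} ⟩
  0                                       ∎)
  where open ≡-Reasoning

avoiders : (n : ℕ) → List (Vec ℕ n)
avoiders 0 = List.[ [] ]
avoiders 1 = List.[ 0 ∷ [] ]
avoiders 2 = (0 ∷ 0 ∷ []) List.∷ List.[ 0 ∷ 1 ∷ [] ]
avoiders (suc (suc (suc n))) =
  List.map singletonFront (avoiders (suc (suc n))) ++
  cartesianProductWith pairFront (allFin (suc n)) (avoiders n)

avoiders-sound : ∀ n → All InΠ-123-12∣3 (avoiders n)
avoiders-sound 0 = from-yes (inΠ? []) ∷ []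
avoiders-sound 1 = from-yes (inΠ? (0 ∷ [])) ∷ []
avoiders-sound 2 = from-yes (inΠ? (0 ∷ 0 ∷ [])) ∷ from-yes (inΠ? (0 ∷ 1 ∷ [])) ∷ []
avoiders-sound (suc (suc (suc n))) =
  All.++⁺ (All.map⁺ (All.map singletonFront-InΠ⁺ (avoiders-sound (suc (suc n)))))
          (All.cartesianProductWith⁺ (setoid _) (setoid _) pairFront (allFin (suc n)) (avoiders n)
             (λ _ w∈ → pairFront-InΠ⁺ (All.lookup (avoiders-sound n) w∈)))

avoiders-complete-step : ∀ {n} →
  (∀ {w : Vec ℕ (2 + n)} → InΠ-123-12∣3 w → w ∈ avoiders (2 + n)) →
  (∀ {w : Vec ℕ n} → InΠ-123-12∣3 w → w ∈ avoiders n) →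
  ∀ {v : Vec ℕ (3 + n)} → InΠ-123-12∣3 v → v ∈ avoiders (3 + n)
avoiders-complete-step {n} complete₂ complete₀ V with decompose V
... | inj₁ (w , refl) = ∈-++⁺ˡ (∈-map⁺ singletonFront (complete₂ (singletonFront-InΠ⁻ V)))
... | inj₂ (p , w , refl) =
  ∈-++⁺ʳ (List.map singletonFront (avoiders (2 + n)))
         (∈-cartesianProductWith⁺ pairFront (∈-allFin p) (complete₀ (pairFront-InΠ⁻ V)))

avoiders-complete : ∀ n {v : Vec ℕ n} → InΠ-123-12∣3 v → v ∈ avoiders n
avoiders-complete 0 {[]} _ = here refl
avoiders-complete 1 {_ ∷ []} (P , _) with head-zero P
... | refl = here refl
avoiders-complete 2 {_ ∷ _ ∷ []} (P , _) with head-zero P | label≤index P (suc zero)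
... | refl | z≤n     = here refl
... | refl | s≤s z≤n = there (here refl)
avoiders-complete (suc (suc (suc n))) =
  avoiders-complete-step (avoiders-complete (suc (suc n))) (avoiders-complete n)

avoiders-unique : ∀ n → Unique (avoiders n)
avoiders-unique 0 = [] ∷ []
avoiders-unique 1 = [] ∷ []
avoiders-unique 2 = ((λ ()) ∷ []) ∷ [] ∷ []
avoiders-unique (suc (suc (suc n))) =
  ++⁺ (map⁺ singletonFront-injective (avoiders-unique (suc (suc n))))
      (cartesianProductWith⁺ pairFront pairFront-injective (allFin⁺ (suc n)) (avoiders-unique n))
      disjoint
  where
  disjoint : Disjoint (List.map singletonFront (avoiders (suc (suc n))))
                      (cartesianProductWith pairFront (allFin (suc n)) (avoiders n))
  disjoint (v∈₁ , v∈₂)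
    with ∈-map⁻ singletonFront v∈₁
       | ∈-cartesianProductWith⁻ pairFront (allFin (suc n)) (avoiders n) v∈₂
  ... | w , _ , refl | p , w′ , _ , _ , eq = singletonFront≢pairFront w p w′ eq

length-avoiders : ∀ n →
  length (avoiders (3 + n)) ≡ length (avoiders (2 + n)) + suc n * length (avoiders n)
length-avoiders n =
  trans (length-++ (List.map singletonFront (avoiders (2 + n))))
        (cong₂ _+_ (length-map singletonFront (avoiders (2 + n)))
                   (trans (length-cartesianProductWith pairFront (allFin (suc n)) (avoiders n))
                          (cong (_* length (avoiders n)) (length-tabulate {n = suc n} (λ i → i)))))

words-unique : ∀ n m → Unique (words n m)
words-unique zero    m = [] ∷ []
words-unique (suc n) m =
  subst Unique (sym (concatMap-map≡cartesianProductWith _∷_ (upTo m) (words n m)))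
        (cartesianProductWith⁺ _∷_ ∷-injective (upTo⁺ m) (words-unique n m))

∈-words : ∀ {n m} (v : Vec ℕ n) → (∀ i → lookup v i < m) → v ∈ words n m
∈-words []      _   = here refl
∈-words {suc n} {m} (x ∷ v) v<m =
  subst (x ∷ v ∈_) (sym (concatMap-map≡cartesianProductWith _∷_ (upTo m) (words n m)))
        (∈-cartesianProductWith⁺ _∷_ (∈-upTo⁺ (v<m zero)) (∈-words v (λ i → v<m (suc i))))

b≡length-avoiders : ∀ n → b n ≡ length (avoiders n)
b≡length-avoiders n =
  unique∧set⇒length≡ (filter⁺ inΠ? (words-unique n n)) (avoiders-unique n) (mk⇔ to from)
  where
  to : ∀ {v} → v ∈ filter inΠ? (words n n) → v ∈ avoiders n
  to v∈ = avoiders-complete n (proj₂ (∈-filter⁻ inΠ? {xs = words n n} v∈))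
  from : ∀ {v} → v ∈ avoiders n → v ∈ filter inΠ? (words n n)
  from {v} v∈ = ∈-filter⁺ inΠ? (∈-words v (label<length (proj₁ V))) V
    where
    V : InΠ-123-12∣3 v
    V = All.lookup (avoiders-sound n) v∈

b-recurrence : ∀ n → b (3 + n) ≡ b (2 + n) + suc n * b n
b-recurrence n = begin
  b (3 + n)                                                 ≡⟨ b≡length-avoiders (3 + n) ⟩
  length (avoiders (3 + n))                                 ≡⟨ length-avoiders n ⟩
  length (avoiders (2 + n)) + suc n * length (avoiders n)   ≡⟨ cong₂ (λ x y → x + suc n * y)
                                                                     (b≡length-avoiders (2 + n))
                                                                     (b≡length-avoiders n) ⟨
  b (2 + n) + suc n * b n                                   ∎
  where open ≡-Reasoning

fromℚᵘ-homo-+ : ∀ p q → fromℚᵘ (p ℚᵘ.+ q) ≡ fromℚᵘ p ℚ.+ fromℚᵘ q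
fromℚᵘ-homo-+ p q = toℚᵘ-injective (ℚᵘ.≃-trans (toℚᵘ-fromℚᵘ (p ℚᵘ.+ q)) (ℚᵘ.≃-sym
  (ℚᵘ.≃-trans (toℚᵘ-homo-+ (fromℚᵘ p) (fromℚᵘ q)) (ℚᵘ.+-cong (toℚᵘ-fromℚᵘ p) (toℚᵘ-fromℚᵘ q)))))

fromℚᵘ-homo-* : ∀ p q → fromℚᵘ (p ℚᵘ.* q) ≡ fromℚᵘ p ℚ.* fromℚᵘ q
fromℚᵘ-homo-* p q = toℚᵘ-injective (ℚᵘ.≃-trans (toℚᵘ-fromℚᵘ (p ℚᵘ.* q)) (ℚᵘ.≃-sym
  (ℚᵘ.≃-trans (toℚᵘ-homo-* (fromℚᵘ p) (fromℚᵘ q)) (ℚᵘ.*-cong (toℚᵘ-fromℚᵘ p) (toℚᵘ-fromℚᵘ q)))))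

-- For d = suc d′, ℤ.+ a ℚ./ d is definitionally fromℚᵘ (mkℚᵘ (ℤ.+ a) d′); this is how the
-- three lemmas below reduce to computations in ℚᵘ.
/-cross : ∀ a c {d e} .{{_ : NonZero d}} .{{_ : NonZero e}} →
          a * e ≡ c * d → ℤ.+ a ℚ./ d ≡ ℤ.+ c ℚ./ e
/-cross a c {suc d} {suc e} eq =
  fromℚᵘ-cong {mkℚᵘ (ℤ.+ a) d} {mkℚᵘ (ℤ.+ c) e}
    (*≡* (trans (sym (pos-* a (suc e))) (trans (cong ℤ.+_ eq) (pos-* c (suc d)))))

*-/ : ∀ m a {d} .{{_ : NonZero d}} → (ℤ.+ m ℚ./ 1) ℚ.* (ℤ.+ a ℚ./ d) ≡ ℤ.+ (m * a) ℚ./ d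
*-/ m a {suc d} = trans (sym (fromℚᵘ-homo-* (mkℚᵘ (ℤ.+ m) 0) (mkℚᵘ (ℤ.+ a) d)))
                        (/-cong (sym (pos-* m a)) (*-identityˡ (suc d)))

+-/ : ∀ a c {d} .{{_ : NonZero d}} → (ℤ.+ a ℚ./ d) ℚ.+ (ℤ.+ c ℚ./ d) ≡ ℤ.+ (a + c) ℚ./ d
+-/ a c {suc d} = trans (sym (fromℚᵘ-homo-+ (mkℚᵘ (ℤ.+ a) d) (mkℚᵘ (ℤ.+ c) d)))
                        (trans (/-cong numerator refl)
                               (/-cross ((a + c) * suc d) (a + c) (*-assoc (a + c) (suc d) (suc d))))
  where
  open ≡-Reasoning
  numerator : ℤ.+ a ℤ.* ℤ.+ suc d ℤ.+ ℤ.+ c ℤ.* ℤ.+ suc d ≡ ℤ.+ ((a + c) * suc d)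
  numerator = begin
    ℤ.+ a ℤ.* ℤ.+ suc d ℤ.+ ℤ.+ c ℤ.* ℤ.+ suc d  ≡⟨ cong₂ ℤ._+_ (pos-* a (suc d)) (pos-* c (suc d)) ⟨
    ℤ.+ (a * suc d) ℤ.+ ℤ.+ (c * suc d)          ≡⟨ pos-+ (a * suc d) (c * suc d) ⟨
    ℤ.+ (a * suc d + c * suc d)                  ≡⟨ cong ℤ.+_ (*-distribʳ-+ (suc d) a c) ⟨
    ℤ.+ ((a + c) * suc d)                        ∎

D-cong : ∀ {f g : Series} → (∀ n → f n ≡ g n) → ∀ n → D f n ≡ D g n
D-cong f≗g n = cong (ℤ.+ suc n ℚ./ 1 ℚ.*_) (f≗g (suc n))

D-egf : ∀ a n → D (egf a) n ≡ egf (λ k → a (suc k)) n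
D-egf a n = trans (*-/ (suc n) (a (suc n)) {{suc n !≢0}})
                  (/-cross (suc n * a (suc n)) (a (suc n)) {{suc n !≢0}} {{n !≢0}}
                           (reorder (suc n) (a (suc n)) (n !)))
  where
  reorder : ∀ k x d → k * x * d ≡ x * (k * d)
  reorder = solve-∀

D²-egf : ∀ a n → D (D (egf a)) n ≡ egf (λ k → a (2 + k)) n
D²-egf a n = trans (D-cong (D-egf a) n) (D-egf (λ k → a (suc k)) n)

D³-egf : ∀ a n → D (D (D (egf a))) n ≡ egf (λ k → a (3 + k)) n
D³-egf a n = trans (D-cong (D-cong (D-egf a)) n) (D²-egf (λ k → a (suc k)) n)

X-D-egf : ∀ a n → X (D (egf a)) n ≡ egf (λ k → k * a k) n
X-D-egf a zero    = refl
X-D-egf a (suc n) = *-/ (suc n) (a (suc n)) {{suc n !≢0}}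

egf-ode : ∀ a → (∀ n → a (3 + n) ≡ a (2 + n) + suc n * a n) →
          ∀ n → D (D (D (egf a))) n ≡ (D (D (egf a)) ⊕ X (D (egf a)) ⊕ egf a) n
egf-ode a rec n = sym (begin
  (D (D (egf a)) ⊕ X (D (egf a)) ⊕ egf a) n
    ≡⟨ cong₂ (λ x y → x ℚ.+ y ℚ.+ egf a n) (D²-egf a n) (X-D-egf a n) ⟩
  egf (λ k → a (2 + k)) n ℚ.+ egf (λ k → k * a k) n ℚ.+ egf a n
    ≡⟨ cong (ℚ._+ egf a n) (+-/ (a (2 + n)) (n * a n) {{n !≢0}}) ⟩
  egf (λ k → a (2 + k) + k * a k) n ℚ.+ egf a n
    ≡⟨ +-/ (a (2 + n) + n * a n) (a n) {{n !≢0}} ⟩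
  egf (λ k → a (2 + k) + k * a k + a k) n
    ≡⟨ cong (λ x → (ℤ.+ x ℚ./ n !) {{n !≢0}}) coefficients ⟩
  egf (λ k → a (3 + k)) n
    ≡⟨ D³-egf a n ⟨
  D (D (D (egf a))) n ∎)
  where
  open ≡-Reasoning
  coefficients : a (2 + n) + n * a n + a n ≡ a (3 + n)
  coefficients = begin
    a (2 + n) + n * a n + a n    ≡⟨ +-assoc (a (2 + n)) (n * a n) (a n) ⟩
    a (2 + n) + (n * a n + a n)  ≡⟨ cong (a (2 + n) +_) (+-comm (n * a n) (a n)) ⟩
    a (2 + n) + suc n * a n      ≡⟨ rec n ⟨
    a (3 + n)                    ∎

proposition5p5 : b 0 ≡ 1 × b 1 ≡ 1 × b 2 ≡ 2
    × (∀ n → 3 ≤ n → b n ≡ b (n ∸ 1) + (n ∸ 2) * b (n ∸ 3))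
    × (∀ k → D (D (D (egf b))) k ≡ (D (D (egf b)) ⊕ X (D (egf b)) ⊕ egf b) k)
proposition5p5 =
  b≡length-avoiders 0 , b≡length-avoiders 1 , b≡length-avoiders 2 ,
  recurrence , egf-ode b b-recurrence
  where
  recurrence : ∀ n → 3 ≤ n → b n ≡ b (n ∸ 1) + (n ∸ 2) * b (n ∸ 3)
  recurrence _ (s≤s (s≤s (s≤s {n = n} _))) = b-recurrence n
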